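{- Let $G=(V,E)$ be a finite simple undirected graph. Let $G_0:=G$ and let $W_1,\dots,W_r$ be distinct subsets of $V$ such that for every $t\in\{1,\dots,r\}$, $W_t$ is a clique of $G_{t-1}$ with $|W_t|\ge2$ and $G_t:=G_{t-1}\mid W_t$. Let $F_0:=STAB(G)$ and $F_t:=\{x\in STAB(G)\mid x_{W_j}=1,\ j=1,\dots,t\}$. Suppose there is $k>0$ such that for all $t\in\{1,\dots,r\}$: (I) $|W_t|=k$ and the subgraph of $G_{t-1}$ induced by $\bigcup_{i=1}^tW_i$ is $k$-partite with vertex classes $V_t^1,\dots,V_t^k$; (II) $T_t:=(V_t,\mathcal W_t)$ is a strong hypertree, where $V_t:=\bigcup_{i=1}^kV_t^i$ and $\mathcal W_t:=\{W_1,\dots,W_t\}$; (III) for all $w\in V_t^0:=V\setminus V_t$ there exists $i\in\{1,\dots,k\}$ such that $N_{G_{t-1}}(w)\cap V_t^i=\emptyset$. Then for all $t\in\{1,\dots,r\}$, the inequality $x_{W_t}\le1$ is facet defining for $F_{t-1}$.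
   Context: For a graph $H$ on vertex set $V$, $STAB(H)\subseteq\mathbb{R}^V$ is the convex hull of the characteristic vectors of the stable sets of $H$. For $x\in\mathbb{R}^V$ and $W\subseteq V$, $x_W=\sum_{v\in W}x_v$. For a graph $H=(V,E_H)$ and a clique $W$ of $H$ with $|W|\ge2$, the clique projection is $H\mid W=(V,E_H\cup\{uv\notin E_H\mid u\ne v,\ W\subseteq N_H(u)\cup N_H(v)\})$, where $N_H(u)$ is the neighborhood of $u$ in $H$. A hypergraph $T_t=(V_t,\mathcal W_t)$ (hyperedges of size $k$) is a strong hypertree if either $\mathcal W_t=\{V_t\}$, or there is a vertex $v\in V_t$ incident to a hyperedge $W_i\in\mathcal W_t$ that shares exactly $k-1$ vertices with some other hyperedge of $T_t$, such that $(V_t\setminus\{v\},\mathcal W_t\setminus\{W_i\})$ is also a strong hypertree. An inequality $a^\top x\le b$ is facet defining for a polytope $P$ if it is valid for $P$ and $\{x\in P\mid a^\top x=b\}$ has dimension $\dim(P)-1$.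
   Formalization: The polytopes $STAB(G)$ and $F_{t-1}$ consist of points of ℚ^V rather than ℝ^V, and affine independence and dimension are taken over the rationals. -}

module Defs where

open import Data.Nat using (ℕ; zero; suc; _∸_)
open import Data.Bool using (Bool; true; false; _∧_; _∨_; not; if_then_else_)
open import Data.Fin using (Fin; zero; suc)
open import Data.Fin.Properties using (_≟_)
open import Data.Vec using (Vec; []; _∷_; tabulate; lookup)
import Data.Vec as Vec
open import Data.List using (List; []; _∷_; map; applyUpTo; foldr; length)
open import Data.List.Membership.Propositional using () renaming (_∈_ to _∈ₗ_)
open import Data.List.Relation.Binary.Permutation.Propositional using (_↭_)
open import Data.Fin.Subset using (Subset; _∈_; _∉_; _∪_; _∩_; _-_; ∣_∣; ⊥; ⊤)
open import Data.Rational using (ℚ; 0ℚ; 1ℚ; _+_; _*_; _≤_)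
open import Data.Product using (Σ; ∃; _×_; _,_)
open import Relation.Binary.PropositionalEquality using (_≡_; _≢_)
open import Relation.Nullary using (¬_; does)

Graph : ℕ → Set
Graph n = Fin n → Fin n → Bool

IsSimpleGraph : ∀ {n} → Graph n → Set
IsSimpleGraph {n} G = (∀ (u v : Fin n) → G u v ≡ G v u) × (∀ (u : Fin n) → G u u ≡ false)

IsClique : ∀ {n} → Graph n → Subset n → Set
IsClique {n} H W = ∀ (u v : Fin n) → u ∈ W → v ∈ W → u ≢ v → H u v ≡ true

allFinB : ∀ {n} → (Fin n → Bool) → Bool
allFinB {n} p = Vec.foldr _ _∧_ true (tabulate p)

coveredB : ∀ {n} → Graph n → Subset n → Fin n → Fin n → Bool
coveredB H W u v = allFinB (λ w → not (lookup W w) ∨ H u w ∨ H v w)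

-- clique projection H | W : add uv (u ≠ v) whenever W ⊆ N_H(u) ∪ N_H(v)
_∣ₚ_ : ∀ {n} → Graph n → Subset n → Graph n
(H ∣ₚ W) u v = H u v ∨ (not (does (u ≟ v)) ∧ coveredB H W u v)

-- the sequence G_0 := G, G_t := G_{t-1} | W_t  (W indexed from 1)
Gseq : ∀ {n} → Graph n → (ℕ → Subset n) → ℕ → Graph n
Gseq G W zero = G
Gseq G W (suc t) = Gseq G W t ∣ₚ W (suc t)

Wlist : ∀ {n} → (ℕ → Subset n) → ℕ → List (Subset n)
Wlist W t = applyUpTo (λ i → W (suc i)) t

Wunion : ∀ {n} → (ℕ → Subset n) → ℕ → Subset n
Wunion W t = foldr _∪_ ⊥ (Wlist W t)

data StrongHypertree {n : ℕ} (k : ℕ) : Subset n → List (Subset n) → Set where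
  single : ∀ (V : Subset n) → StrongHypertree k V (V ∷ [])
  step   : ∀ (V : Subset n) (Ws : List (Subset n)) (v : Fin n) (Wi : Subset n)
             (Ws' : List (Subset n)) →
           Ws ↭ (Wi ∷ Ws') →
           v ∈ V → v ∈ Wi →
           (Σ (Subset n) λ W' → W' ∈ₗ Ws' × W' ≢ Wi × ∣ Wi ∩ W' ∣ ≡ k ∸ 1) →
           StrongHypertree k (V - v) Ws' →
           StrongHypertree k V Ws

Point : ℕ → Set
Point n = Fin n → ℚ

sumFin : ∀ {n} → (Fin n → ℚ) → ℚ
sumFin {zero} f = 0ℚ
sumFin {suc n} f = f zero + sumFin (λ i → f (suc i))

xsum : ∀ {n} → Point n → Subset n → ℚ
xsum x W = sumFin (λ v → if lookup W v then x v else 0ℚ)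

IsStable : ∀ {n} → Graph n → Subset n → Set
IsStable {n} H S = ∀ (u v : Fin n) → u ∈ S → v ∈ S → H u v ≡ false

χ : ∀ {n} → Subset n → Point n
χ S v = if lookup S v then 1ℚ else 0ℚ

sumList : List ℚ → ℚ
sumList = foldr _+_ 0ℚ

STAB : ∀ {n} → Graph n → Point n → Set
STAB {n} H x =
  Σ (List (ℚ × Subset n)) λ cs →
    (∀ {l S} → (l , S) ∈ₗ cs → (0ℚ ≤ l × IsStable H S)) ×
    sumList (map (λ { (l , S) → l }) cs) ≡ 1ℚ ×
    (∀ (v : Fin n) → x v ≡ sumList (map (λ { (l , S) → l * χ S v }) cs))

AffinelyIndependent : ∀ {n m} → (Fin m → Point n) → Set
AffinelyIndependent {n} {m} p =
  ∀ (μ : Fin m → ℚ) →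
    sumFin μ ≡ 0ℚ →
    (∀ (v : Fin n) → sumFin (λ j → μ j * p j v) ≡ 0ℚ) →
    ∀ (j : Fin m) → μ j ≡ 0ℚ

-- the maximum number of affinely independent points of P is m
-- (i.e. dim P = m - 1, with dim ∅ = -1)
MaxAffInd : ∀ {n} → (Point n → Set) → ℕ → Set
MaxAffInd {n} P m =
  (Σ (Fin m → Point n) λ p → (∀ j → P (p j)) × AffinelyIndependent p) ×
  (∀ (m' : ℕ) (p : Fin m' → Point n) → (∀ j → P (p j)) → AffinelyIndependent p →
     m' Data.Nat.≤ m)

-- a·x ≤ b is facet defining for P: valid, and dim {x ∈ P | a·x = b} = dim P - 1
FacetDefining : ∀ {n} → (Point n → Set) → (Point n → ℚ) → ℚ → Set
FacetDefining {n} P a b =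
  (∀ x → P x → a x ≤ b) ×
  Σ ℕ λ m → MaxAffInd P (suc m) × MaxAffInd (λ x → P x × a x ≡ b) m

Fface : ∀ {n} → Graph n → (ℕ → Subset n) → ℕ → Point n → Set
Fface G W t x = STAB G x × (∀ (j : ℕ) → 1 Data.Nat.≤ j → j Data.Nat.≤ t → xsum x (W j) ≡ 1ℚ)

{-# OPTIONS --safe #-}
module Submission where

-- Validity: if x ∈ F_{t-1}, tightness of x_{W_j} ≤ 1 (j < t) forces every stable set of a
-- convex representation of x to meet W_1, …, W_{t-1}; such sets stay stable under the
-- clique projections, so x ∈ STAB(G_{t-1}), in which W_t is a clique.
-- Dimension: by (II), |W_1 ∪ … ∪ W_t| = k + t - 1, so each W_j has a vertex outside the
-- earlier hyperedges, and the equations x_{W_j} = 1 determine these t coordinates from the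
-- others: F_t has at most n - t + 1 affinely independent points. By (I) and (III) this is
-- attained by the colour classes of V_t together with, for each w ∉ V_t, a class without
-- neighbours of w plus w itself. Removing the new vertex of W_t from its colour class gives
-- a point of F_{t-1} off the face.

open import Defs
open import Algebra.Bundles using (CommutativeRing)
open import Data.Bool.Base using (Bool; true; false; _∧_; _∨_; not; if_then_else_)
import Data.Bool.Properties as Boolₚ
open import Data.Bool.Properties using (∧-conicalˡ; ∧-conicalʳ; ∧-identityʳ)
open import Data.Empty using (⊥-elim)
open import Data.Fin.Base as Fin using (Fin; zero; suc; punchIn; toℕ)
import Data.Fin.Properties as Finₚ
open import Data.Fin.Properties using (_≟_)
open import Data.Fin.Subset using (Subset; _∈_; _∉_; _∪_; _-_; ∣_∣; ⋃; ⊥)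
import Data.Fin.Subset.Properties as Subsetₚ
import Data.Fin.Induction as Finᵢ
open import Data.List.Base using (List; []; _∷_; length; map)
import Data.List.Properties as Listₚ
open import Data.List.Membership.Propositional using () renaming (_∈_ to _∈ₗ_)
open import Data.List.Membership.Propositional.Properties using (∈-map⁺; ∈-map⁻; ∈-applyUpTo⁺; ∈-applyUpTo⁻)
open import Data.List.Relation.Binary.Permutation.Propositional using (↭-sym)
open import Data.List.Relation.Binary.Permutation.Propositional.Properties using (∈-resp-↭; ↭-length)
open import Data.List.Relation.Unary.Any using (here; there)
open import Data.Maybe.Base using (Maybe; just; nothing)
open import Data.Nat.Base as ℕ using (ℕ; zero; suc; z≤n; s≤s; _∸_; _≤_; _<_)
import Data.Nat.Properties as ℕₚ
open import Data.Product as Product using (Σ; ∃; _×_; _,_; proj₁; proj₂)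
open import Data.Rational.Base as ℚ using (ℚ; 0ℚ; 1ℚ; _+_; _*_; -_; 1/_)
import Data.Rational.Properties as ℚₚ
open import Data.Rational.Solver using (module +-*-Solver)
open import Data.Sum using (_⊎_; inj₁; inj₂)
open import Data.Vec.Base using ([]; _∷_; lookup; tabulate; here; there)
import Data.Vec.Properties as Vecₚ
import Data.Vec.Functional as Vector
open import Data.Vec.Functional.Properties using (insertAt-lookup; insertAt-punchIn)
open import Function.Base using (_∘_; id)
open import Induction.WellFounded using (module All)
open import Level using (0ℓ)
open import Relation.Binary.Definitions using (tri<; tri≈; tri>)
open import Relation.Binary.PropositionalEquality
open import Relation.Nullary using (yes; no; ¬?; does; _×-dec_)
open import Relation.Nullary.Decidable using (decidable-stable; dec-true; dec-false)

open import Algebra.Properties.Group ℚₚ.+-0-group using (∙-cancelˡ)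
open import Algebra.Properties.Semiring.Sum (CommutativeRing.semiring ℚₚ.+-*-commutativeRing)
  using (sum; sum-cong-≗; sum-remove; ∑-distrib-+; ∑-comm; *-distribˡ-sum)

open ≡-Reasoning

-- Finite sums

sumFin≡sum : ∀ {n} (f : Fin n → ℚ) → sumFin f ≡ sum f
sumFin≡sum {zero}  f = refl
sumFin≡sum {suc n} f = cong (f zero +_) (sumFin≡sum (f ∘ suc))

sumFin-cong : ∀ {n} {f g : Fin n → ℚ} → (∀ i → f i ≡ g i) → sumFin f ≡ sumFin g
sumFin-cong {zero}  f≗g = refl
sumFin-cong {suc n} f≗g = cong₂ _+_ (f≗g zero) (sumFin-cong (f≗g ∘ suc))

sumFin-zero : ∀ {n} {f : Fin n → ℚ} → (∀ i → f i ≡ 0ℚ) → sumFin f ≡ 0ℚ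
sumFin-zero {zero}  f≗0 = refl
sumFin-zero {suc n} f≗0 = cong₂ _+_ (f≗0 zero) (sumFin-zero (f≗0 ∘ suc))

sumFin-distrib-+ : ∀ {n} (f g : Fin n → ℚ) → sumFin (λ i → f i + g i) ≡ sumFin f + sumFin g
sumFin-distrib-+ f g = begin
  sumFin (λ i → f i + g i) ≡⟨ sumFin≡sum (λ i → f i + g i) ⟩
  sum (λ i → f i + g i)    ≡⟨ ∑-distrib-+ f g ⟩
  sum f + sum g            ≡⟨ cong₂ _+_ (sumFin≡sum f) (sumFin≡sum g) ⟨
  sumFin f + sumFin g      ∎

*-distribˡ-sumFin : ∀ {n} c (f : Fin n → ℚ) → c * sumFin f ≡ sumFin (λ i → c * f i)
*-distribˡ-sumFin c f = begin
  c * sumFin f           ≡⟨ cong (c *_) (sumFin≡sum f) ⟩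
  c * sum f              ≡⟨ *-distribˡ-sum c f ⟩
  sum (λ i → c * f i)    ≡⟨ sumFin≡sum (λ i → c * f i) ⟨
  sumFin (λ i → c * f i) ∎

sumFin-comm : ∀ {m n} (f : Fin m → Fin n → ℚ) →
              sumFin (λ i → sumFin (f i)) ≡ sumFin (λ j → sumFin (λ i → f i j))
sumFin-comm f = begin
  sumFin (λ i → sumFin (f i))         ≡⟨ sumFin≡sum (λ i → sumFin (f i)) ⟩
  sum (λ i → sumFin (f i))            ≡⟨ sum-cong-≗ (λ i → sumFin≡sum (f i)) ⟩
  sum (λ i → sum (f i))               ≡⟨ ∑-comm f ⟩
  sum (λ j → sum (λ i → f i j))       ≡⟨ sum-cong-≗ (λ j → sumFin≡sum (λ i → f i j)) ⟨
  sum (λ j → sumFin (λ i → f i j))    ≡⟨ sumFin≡sum (λ j → sumFin (λ i → f i j)) ⟨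
  sumFin (λ j → sumFin (λ i → f i j)) ∎

sumFin-remove : ∀ {n} (i : Fin (suc n)) (f : Fin (suc n) → ℚ) →
                sumFin f ≡ f i + sumFin (f ∘ punchIn i)
sumFin-remove i f = begin
  sumFin f                     ≡⟨ sumFin≡sum f ⟩
  sum f                        ≡⟨ sum-remove {i = i} f ⟩
  f i + sum (f ∘ punchIn i)    ≡⟨ cong (f i +_) (sumFin≡sum (f ∘ punchIn i)) ⟨
  f i + sumFin (f ∘ punchIn i) ∎

sumFin-single : ∀ {n} (i : Fin n) (f : Fin n → ℚ) → (∀ j → j ≢ i → f j ≡ 0ℚ) → sumFin f ≡ f i
sumFin-single {suc n} i f f≗0 = begin
  sumFin f                     ≡⟨ sumFin-remove i f ⟩
  f i + sumFin (f ∘ punchIn i) ≡⟨ cong (f i +_) (sumFin-zero (λ j → f≗0 _ (Finₚ.punchInᵢ≢i i j))) ⟩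
  f i + 0ℚ                     ≡⟨ ℚₚ.+-identityʳ (f i) ⟩
  f i                          ∎

p*q≡0⇒p≡0 : ∀ {p q : ℚ} → q ≢ 0ℚ → p * q ≡ 0ℚ → p ≡ 0ℚ
p*q≡0⇒p≡0 {p} {q} q≢0 pq≡0 = begin
  p                ≡⟨ ℚₚ.*-identityʳ p ⟨
  p * 1ℚ           ≡⟨ cong (p *_) (ℚₚ.*-inverseʳ q) ⟨
  p * (q * 1/ q)   ≡⟨ ℚₚ.*-assoc p q (1/ q) ⟨
  p * q * 1/ q     ≡⟨ cong (_* 1/ q) pq≡0 ⟩
  0ℚ * 1/ q        ≡⟨ ℚₚ.*-zeroˡ (1/ q) ⟩
  0ℚ               ∎
  where instance _ = ℚ.≢-nonZero q≢0

sumList-mono : ∀ {A : Set} (f g : A → ℚ) (cs : List A) → (∀ c → c ∈ₗ cs → f c ℚ.≤ g c) →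
               sumList (map f cs) ℚ.≤ sumList (map g cs)
sumList-mono f g []       _   = ℚₚ.≤-refl
sumList-mono f g (c ∷ cs) f≤g = ℚₚ.+-mono-≤ (f≤g c (here refl)) (sumList-mono f g cs (λ c′ → f≤g c′ ∘ there))

+-cancelʳ-≤ : ∀ {x y} z → x + z ℚ.≤ y + z → x ℚ.≤ y
+-cancelʳ-≤ {x} {y} z x+z≤y+z = subst₂ ℚ._≤_ (undo x) (undo y) (ℚₚ.+-monoˡ-≤ (- z) x+z≤y+z)
  where
  undo : ∀ a → a + z + - z ≡ a
  undo a = trans (ℚₚ.+-assoc a z (- z)) (trans (cong (a +_) (ℚₚ.+-inverseʳ z)) (ℚₚ.+-identityʳ a))

sumList-tight : ∀ {A : Set} (f g : A → ℚ) (cs : List A) → (∀ c → c ∈ₗ cs → f c ℚ.≤ g c) →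
                sumList (map f cs) ≡ sumList (map g cs) → ∀ c → c ∈ₗ cs → f c ≡ g c
sumList-tight f g (c ∷ cs) f≤g Σf≡Σg = tight
  where
  F = sumList (map f cs)
  G = sumList (map g cs)
  F≤G : F ℚ.≤ G
  F≤G = sumList-mono f g cs (λ c′ → f≤g c′ ∘ there)
  g≤f : g c ℚ.≤ f c
  g≤f = +-cancelʳ-≤ F (subst (g c + F ℚ.≤_) (sym Σf≡Σg) (ℚₚ.+-monoʳ-≤ (g c) F≤G))
  f≡g : f c ≡ g c
  f≡g = ℚₚ.≤-antisym (f≤g c (here refl)) g≤f
  F≡G : F ≡ G
  F≡G = ∙-cancelˡ (f c) F G (trans Σf≡Σg (cong (_+ G) (sym f≡g)))
  tight : ∀ c′ → c′ ∈ₗ (c ∷ cs) → f c′ ≡ g c′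
  tight _ (here refl)  = f≡g
  tight c′ (there c′∈) = sumList-tight f g cs (λ c″ → f≤g c″ ∘ there) F≡G c′ c′∈

-- Linear dependence

combination : ∀ {A : Set} {m} → (Fin m → ℚ) → (Fin m → A → ℚ) → A → ℚ
combination μ a x = sumFin (λ j → μ j * a j x)

LinearlyDependentOn : ∀ {A : Set} {m} → List A → (Fin m → A → ℚ) → Set
LinearlyDependentOn {m = m} L a =
  Σ (Fin m → ℚ) λ μ → (∃ λ j → μ j ≢ 0ℚ) × (∀ x → x ∈ₗ L → combination μ a x ≡ 0ℚ)

dependentOn-[] : ∀ {A : Set} {m} (a : Fin (suc m) → A → ℚ) → LinearlyDependentOn [] a
dependentOn-[] a = (λ _ → 1ℚ) , (zero , ℚₚ.1≢0) , λ _ ()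

dependentOn-∷-zeroColumn : ∀ {A : Set} {m} {L : List A} {a : Fin m → A → ℚ} {x : A} →
                           (∀ j → a j x ≡ 0ℚ) → LinearlyDependentOn L a → LinearlyDependentOn (x ∷ L) a
dependentOn-∷-zeroColumn {a = a} {x} column≡0 (μ , μ≢0 , μa≡0) = μ , μ≢0 , vanishes
  where
  vanishes : ∀ y → y ∈ₗ (x ∷ _) → combination μ a y ≡ 0ℚ
  vanishes y (here refl)  = sumFin-zero (λ j → trans (cong (μ j *_) (column≡0 j)) (ℚₚ.*-zeroʳ (μ j)))
  vanishes y (there y∈L) = μa≡0 y y∈L

module GaussStep {A : Set} {m} (a : Fin (suc m) → A → ℚ) (x : A)
                 (p : Fin (suc m)) (a[p,x]≢0 : a p x ≢ 0ℚ) where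

  open +-*-Solver
  private instance _ = ℚ.≢-nonZero a[p,x]≢0

  factor : Fin m → ℚ
  factor j = a (punchIn p j) x * 1/ a p x

  reduced : Fin m → A → ℚ
  reduced j y = a (punchIn p j) y + - (factor j * a p y)

  reduced-column : ∀ j → reduced j x ≡ 0ℚ
  reduced-column j = begin
    b + - (b * 1/ c * c)   ≡⟨ solve 3 (λ b d c → b :+ :- (b :* d :* c) := b :+ :- (b :* (c :* d))) refl b (1/ c) c ⟩
    b + - (b * (c * 1/ c)) ≡⟨ cong (λ e → b + - (b * e)) (ℚₚ.*-inverseʳ c) ⟩
    b + - (b * 1ℚ)         ≡⟨ solve 1 (λ b → b :+ :- (b :* con 1ℚ) := con 0ℚ) refl b ⟩
    0ℚ                     ∎
    where b = a (punchIn p j) x; c = a p x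

  lift : (Fin m → ℚ) → Fin (suc m) → ℚ
  lift ν = Vector.insertAt ν p (- sumFin (λ j → ν j * factor j))

  combination-lift : ∀ ν y → combination (lift ν) a y ≡ combination ν reduced y
  combination-lift ν y = begin
    combination (lift ν) a y
      ≡⟨ sumFin-remove p (λ i → lift ν i * a i y) ⟩
    lift ν p * a p y + sumFin (λ j → lift ν (punchIn p j) * a (punchIn p j) y)
      ≡⟨ cong₂ _+_ (cong (_* a p y) (insertAt-lookup ν p _))
                   (sumFin-cong (λ j → cong (_* a (punchIn p j) y) (insertAt-punchIn ν p _ j))) ⟩
    - S * a p y + A′
      ≡⟨ solve 3 (λ S B A′ → :- S :* B :+ A′ := A′ :+ :- B :* S) refl S (a p y) A′ ⟩
    A′ + - a p y * S
      ≡⟨ cong (A′ +_) (*-distribˡ-sumFin (- a p y) (λ j → ν j * factor j)) ⟩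
    A′ + sumFin (λ j → - a p y * (ν j * factor j))
      ≡⟨ sumFin-distrib-+ (λ j → ν j * a (punchIn p j) y) (λ j → - a p y * (ν j * factor j)) ⟨
    sumFin (λ j → ν j * a (punchIn p j) y + - a p y * (ν j * factor j))
      ≡⟨ sumFin-cong (λ j → solve 4 (λ n b c f → n :* b :+ :- c :* (n :* f) := n :* (b :+ :- (f :* c)))
                                    refl (ν j) (a (punchIn p j) y) (a p y) (factor j)) ⟩
    combination ν reduced y
      ∎
    where S  = sumFin (λ j → ν j * factor j)
          A′ = sumFin (λ j → ν j * a (punchIn p j) y)

  dependentOn-∷ : ∀ {L} → LinearlyDependentOn L reduced → LinearlyDependentOn (x ∷ L) a
  dependentOn-∷ {L} (ν , (j , ν[j]≢0) , νr≡0) = lift ν , (punchIn p j , lift≢0) , vanishes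
    where
    lift≢0 : lift ν (punchIn p j) ≢ 0ℚ
    lift≢0 = ν[j]≢0 ∘ trans (sym (insertAt-punchIn ν p _ j))
    vanishes : ∀ y → y ∈ₗ (x ∷ L) → combination (lift ν) a y ≡ 0ℚ
    vanishes y (here refl)  = trans (combination-lift ν x)
      (sumFin-zero (λ i → trans (cong (ν i *_) (reduced-column i)) (ℚₚ.*-zeroʳ (ν i))))
    vanishes y (there y∈L) = trans (combination-lift ν y) (νr≡0 y y∈L)

length<⇒dependentOn : ∀ {A : Set} {m} (L : List A) (a : Fin m → A → ℚ) →
                      length L < m → LinearlyDependentOn L a
length<⇒dependentOn [] a (s≤s _) = dependentOn-[] a
length<⇒dependentOn (x ∷ L) a (s≤s |L|<m) with Finₚ.any? (λ j → ¬? (a j x ℚₚ.≟ 0ℚ))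
... | yes (p , a[p,x]≢0) =
  GaussStep.dependentOn-∷ a x p a[p,x]≢0 (length<⇒dependentOn L (GaussStep.reduced a x p a[p,x]≢0) |L|<m)
... | no ¬nonzero = dependentOn-∷-zeroColumn {a = a}
  (λ j → decidable-stable (a j x ℚₚ.≟ 0ℚ) (λ a[j,x]≢0 → ¬nonzero (j , a[j,x]≢0)))
  (length<⇒dependentOn L a (ℕₚ.m≤n⇒m≤1+n |L|<m))

-- Subsets of Fin n as Boolean predicates

true≢false : true ≢ false
true≢false ()

does⇒≡ : ∀ {n} {a b : Fin n} → does (a ≟ b) ≡ true → a ≡ b
does⇒≡ {a = a} {b} eq with a ≟ b
... | yes a≡b = a≡b

count : ∀ {n} → (Fin n → Bool) → ℕ
count {zero}  f = 0
count {suc n} f = if f zero then suc (count (f ∘ suc)) else count (f ∘ suc)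

_without_ : ∀ {n} → (Fin n → Bool) → Fin n → Fin n → Bool
(f without w) v = f v ∧ not (does (v ≟ w))

without-⊆ : ∀ {n} (f : Fin n → Bool) {w v} → (f without w) v ≡ true → f v ≡ true
without-⊆ f {v = v} = ∧-conicalˡ (f v) _

without-≢ : ∀ {n} (f : Fin n → Bool) {w v} → (f without w) v ≡ true → v ≢ w
without-≢ f {v = v} f′v refl with v ≟ v | ∧-conicalʳ (f v) _ f′v
... | yes _  | ()
... | no v≢v | _ = v≢v refl

without⁺ : ∀ {n} (f : Fin n → Bool) {w v} → f v ≡ true → v ≢ w → (f without w) v ≡ true
without⁺ f {w} {v} fv v≢w rewrite fv | dec-false (v ≟ w) v≢w = refl

count-cong : ∀ {n} {f g : Fin n → Bool} → (∀ v → f v ≡ g v) → count f ≡ count g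
count-cong {zero}          _   = refl
count-cong {suc n} {g = g} f≗g rewrite f≗g zero with g zero
... | true  = cong suc (count-cong (f≗g ∘ suc))
... | false = count-cong (f≗g ∘ suc)

count-true : ∀ n → count {n} (λ _ → true) ≡ n
count-true zero    = refl
count-true (suc n) = cong suc (count-true n)

count-complement : ∀ {n} (f : Fin n → Bool) → count f ℕ.+ count (not ∘ f) ≡ n
count-complement {zero}  f = refl
count-complement {suc n} f with f zero
... | true  = cong suc (count-complement (f ∘ suc))
... | false = trans (ℕₚ.+-suc _ _) (cong suc (count-complement (f ∘ suc)))

count-without : ∀ {n} (f : Fin n → Bool) {w} → f w ≡ true → suc (count (f without w)) ≡ count f
count-without {suc n} f {zero}  f₀ rewrite f₀ = cong suc (count-cong (λ v → ∧-identityʳ (f (suc v))))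
count-without {suc n} f {suc w} fw with f zero
... | true  = cong suc (count-without (f ∘ suc) fw)
... | false = count-without (f ∘ suc) fw

0<count⇒∃ : ∀ {n} (f : Fin n → Bool) → 0 < count f → ∃ λ v → f v ≡ true
0<count⇒∃ {suc n} f 0<|f| with f zero in f₀
... | true  = zero , f₀
... | false = Product.map suc id (0<count⇒∃ (f ∘ suc) 0<|f|)

count<count⇒∃ : ∀ {n} (f g : Fin n → Bool) → count f < count g → ∃ λ v → g v ≡ true × f v ≡ false
count<count⇒∃ {suc n} f g |f|<|g| with f zero in f₀ | g zero in g₀
... | false | true  = zero , g₀ , f₀
... | true  | true  = Product.map suc id (count<count⇒∃ (f ∘ suc) (g ∘ suc) (ℕₚ.≤-pred |f|<|g|))
... | true  | false = Product.map suc id (count<count⇒∃ (f ∘ suc) (g ∘ suc) (ℕₚ.<-trans (ℕₚ.n<1+n _) |f|<|g|))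
... | false | false = Product.map suc id (count<count⇒∃ (f ∘ suc) (g ∘ suc) |f|<|g|)

count-injective : ∀ {n m} (g : Fin n → Bool) (h : Fin n → Fin m) (A : Fin m → Bool) →
                  (∀ u → g u ≡ true → A (h u) ≡ true) →
                  (∀ u v → g u ≡ true → g v ≡ true → h u ≡ h v → u ≡ v) →
                  count g ≤ count A
count-injective {zero}  g h A into inj = z≤n
count-injective {suc n} g h A into inj with g zero in g₀
... | false = count-injective (g ∘ suc) (h ∘ suc) A (into ∘ suc)
                (λ u v gu gv eq → Finₚ.suc-injective (inj (suc u) (suc v) gu gv eq))
... | true  = ℕₚ.≤-trans (s≤s (count-injective (g ∘ suc) (h ∘ suc) (A without h zero) into′ inj′))
                         (ℕₚ.≤-reflexive (count-without A (into zero g₀)))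
  where
  into′ : ∀ u → g (suc u) ≡ true → (A without h zero) (h (suc u)) ≡ true
  into′ u gu = without⁺ A (into (suc u) gu) (Finₚ.0≢1+n ∘ sym ∘ inj (suc u) zero gu g₀)
  inj′ : ∀ u v → g (suc u) ≡ true → g (suc v) ≡ true → h (suc u) ≡ h (suc v) → u ≡ v
  inj′ u v gu gv eq = Finₚ.suc-injective (inj (suc u) (suc v) gu gv eq)

injective⇒onto : ∀ {n k} (g : Fin n → Bool) (h : Fin n → Fin k) → count g ≡ k →
                 (∀ u v → g u ≡ true → g v ≡ true → h u ≡ h v → u ≡ v) →
                 ∀ i → ∃ λ u → g u ≡ true × h u ≡ i
injective⇒onto {k = k} g h |g|≡k inj i with Finₚ.any? (λ u → (g u Boolₚ.≟ true) ×-dec (h u ≟ i))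
... | yes hit = hit
... | no ¬hit = ⊥-elim (ℕₚ.<-irrefl refl (ℕₚ.≤-trans (s≤s |g|≤k-1) (ℕₚ.≤-reflexive |k-1|≡|g|)))
  where
  others : Fin k → Bool
  others = (λ _ → true) without i
  |g|≤k-1 : count g ≤ count others
  |g|≤k-1 = count-injective g h others (λ u gu → without⁺ (λ _ → true) refl (λ hu≡i → ¬hit (u , gu , hu≡i))) inj
  |k-1|≡|g| : suc (count others) ≡ count g
  |k-1|≡|g| = trans (count-without {k} (λ _ → true) {i} refl) (trans (count-true k) (sym |g|≡k))

∣∣≡count : ∀ {n} (S : Subset n) → ∣ S ∣ ≡ count (lookup S)
∣∣≡count []          = refl
∣∣≡count (true ∷ S)  = cong suc (∣∣≡count S)
∣∣≡count (false ∷ S) = ∣∣≡count S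

enumerate : ∀ {n} → (Fin n → Bool) → List (Fin n)
enumerate {zero}  f = []
enumerate {suc n} f with f zero
... | true  = zero ∷ map suc (enumerate (f ∘ suc))
... | false = map suc (enumerate (f ∘ suc))

length-enumerate : ∀ {n} (f : Fin n → Bool) → length (enumerate f) ≡ count f
length-enumerate {zero}  f = refl
length-enumerate {suc n} f with f zero
... | true  = cong suc (trans (Listₚ.length-map suc (enumerate (f ∘ suc))) (length-enumerate (f ∘ suc)))
... | false = trans (Listₚ.length-map suc (enumerate (f ∘ suc))) (length-enumerate (f ∘ suc))

∈-enumerate : ∀ {n} (f : Fin n → Bool) {v} → f v ≡ true → v ∈ₗ enumerate f
∈-enumerate {suc n} f {v} fv with f zero in f₀ | v
... | true  | zero  = here refl
... | true  | suc u = there (∈-map⁺ suc (∈-enumerate (f ∘ suc) fv))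
... | false | zero  with () ← trans (sym f₀) fv
... | false | suc u = ∈-map⁺ suc (∈-enumerate (f ∘ suc) fv)

-- Coordinate sums

xsum-zero : ∀ {n} {x : Point n} (S : Subset n) → (∀ v → x v ≡ 0ℚ) → xsum x S ≡ 0ℚ
xsum-zero {x = x} S x≗0 = sumFin-zero term≡0
  where
  term≡0 : ∀ v → (if lookup S v then x v else 0ℚ) ≡ 0ℚ
  term≡0 v with lookup S v
  ... | true  = x≗0 v
  ... | false = refl

xsum-cong : ∀ {n} {x y : Point n} (S : Subset n) → (∀ v → x v ≡ y v) → xsum x S ≡ xsum y S
xsum-cong S x≗y = sumFin-cong (λ v → cong (if lookup S v then_else 0ℚ) (x≗y v))

xsum-+ : ∀ {n} (x y : Point n) (S : Subset n) → xsum (λ v → x v + y v) S ≡ xsum x S + xsum y S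
xsum-+ x y S = trans (sumFin-cong split) (sumFin-distrib-+ (restrict x) (restrict y))
  where
  restrict : Point _ → Point _
  restrict z v = if lookup S v then z v else 0ℚ
  split : ∀ v → restrict (λ u → x u + y u) v ≡ restrict x v + restrict y v
  split v with lookup S v
  ... | true  = refl
  ... | false = refl

xsum-*ˡ : ∀ {n} l (x : Point n) (S : Subset n) → xsum (λ v → l * x v) S ≡ l * xsum x S
xsum-*ˡ l x S = trans (sumFin-cong pull) (sym (*-distribˡ-sumFin l (λ v → if lookup S v then x v else 0ℚ)))
  where
  pull : ∀ v → (if lookup S v then l * x v else 0ℚ) ≡ l * (if lookup S v then x v else 0ℚ)
  pull v with lookup S v
  ... | true  = refl
  ... | false = sym (ℚₚ.*-zeroʳ l)

xsum-combination : ∀ {n m} (μ : Fin m → ℚ) (p : Fin m → Point n) (S : Subset n) →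
                   xsum (combination μ p) S ≡ sumFin (λ j → μ j * xsum (p j) S)
xsum-combination μ p S = begin
  xsum (combination μ p) S                            ≡⟨ sumFin-cong restrict-combination ⟩
  sumFin (λ v → sumFin (λ j → μ j * restrict (p j) v)) ≡⟨ sumFin-comm (λ v j → μ j * restrict (p j) v) ⟩
  sumFin (λ j → sumFin (λ v → μ j * restrict (p j) v)) ≡⟨ sumFin-cong (λ j →
                                                           *-distribˡ-sumFin (μ j) (restrict (p j))) ⟨
  sumFin (λ j → μ j * xsum (p j) S)                   ∎
  where
  restrict : Point _ → Point _
  restrict x v = if lookup S v then x v else 0ℚ
  restrict-combination : ∀ v → restrict (combination μ p) v ≡ sumFin (λ j → μ j * restrict (p j) v)
  restrict-combination v with lookup S v
  ... | true  = refl
  ... | false = sym (sumFin-zero (λ j → ℚₚ.*-zeroʳ (μ j)))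

indicator : ∀ {n} → (Fin n → Bool) → Point n
indicator f v = if f v then 1ℚ else 0ℚ

indicator-true : ∀ {n} (f : Fin n → Bool) {v} → f v ≡ true → indicator f v ≡ 1ℚ
indicator-true _ = cong (if_then 1ℚ else 0ℚ)

indicator-false : ∀ {n} (f : Fin n → Bool) {v} → f v ≡ false → indicator f v ≡ 0ℚ
indicator-false _ = cong (if_then 1ℚ else 0ℚ)

MeetsOnce : ∀ {n} → (Fin n → Bool) → Subset n → Set
MeetsOnce f W =
  ∃ λ u → lookup W u ≡ true × f u ≡ true × (∀ u′ → lookup W u′ ≡ true → f u′ ≡ true → u′ ≡ u)

MeetsOnce-cong : ∀ {n} {f g : Fin n → Bool} {W : Subset n} →
                 (∀ u → lookup W u ≡ true → f u ≡ g u) → MeetsOnce f W → MeetsOnce g W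
MeetsOnce-cong f≗g (u , Wu , fu , unique) =
  u , Wu , trans (sym (f≗g u Wu)) fu , λ u′ Wu′ gu′ → unique u′ Wu′ (trans (f≗g u′ Wu′) gu′)

xsum-indicator-once : ∀ {n} {f : Fin n → Bool} {W : Subset n} → MeetsOnce f W → xsum (indicator f) W ≡ 1ℚ
xsum-indicator-once {f = f} {W} (u , Wu , fu , unique) = trans (sumFin-single u _ others) at-u
  where
  at-u : (if lookup W u then indicator f u else 0ℚ) ≡ 1ℚ
  at-u rewrite Wu | fu = refl
  others : ∀ u′ → u′ ≢ u → (if lookup W u′ then indicator f u′ else 0ℚ) ≡ 0ℚ
  others u′ u′≢u with lookup W u′ in Wu′ | f u′ in fu′
  ... | false | _     = refl
  ... | true  | false = refl
  ... | true  | true  = ⊥-elim (u′≢u (unique u′ Wu′ fu′))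

xsum-indicator-disjoint : ∀ {n} {f : Fin n → Bool} {W : Subset n} →
                          (∀ u → lookup W u ≡ true → f u ≡ false) → xsum (indicator f) W ≡ 0ℚ
xsum-indicator-disjoint {f = f} {W} disjoint = sumFin-zero term≡0
  where
  term≡0 : ∀ u → (if lookup W u then indicator f u else 0ℚ) ≡ 0ℚ
  term≡0 u with lookup W u in Wu
  ... | false = refl
  ... | true rewrite disjoint u Wu = refl

-- Affine independence

homogenise : ∀ {n} → Point n → Maybe (Fin n) → ℚ
homogenise x nothing  = 1ℚ
homogenise x (just v) = x v

-- The coordinate nothing is constantly 1, so a linear dependence between homogenised
-- points is an affine dependence between the points.
affinelyIndependent-bound : ∀ {n m} (f : Fin n → Bool) (p : Fin m → Point n) → AffinelyIndependent p →
  (∀ μ → sumFin μ ≡ 0ℚ → (∀ v → f v ≡ true → combination μ p v ≡ 0ℚ) →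
         ∀ v → combination μ p v ≡ 0ℚ) →
  m ≤ suc (count f)
affinelyIndependent-bound {m = m} f p indep determined with m ℕₚ.≤? suc (count f)
... | yes m≤1+|f| = m≤1+|f|
... | no m≰1+|f|
  with length<⇒dependentOn (nothing ∷ map just (enumerate f)) (homogenise ∘ p)
         (subst (_< m) (cong suc (sym (trans (Listₚ.length-map just (enumerate f)) (length-enumerate f))))
                (ℕₚ.≰⇒> m≰1+|f|))
... | μ , (j , μ[j]≢0) , μp≡0 =
  ⊥-elim (μ[j]≢0 (indep μ Σμ≡0
    (determined μ Σμ≡0 (λ v fv → μp≡0 (just v) (there (∈-map⁺ just (∈-enumerate f fv))))) j))
  where
  Σμ≡0 : sumFin μ ≡ 0ℚ
  Σμ≡0 = trans (sumFin-cong (λ i → sym (ℚₚ.*-identityʳ (μ i)))) (μp≡0 nothing (here refl))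

affinelyIndependent-∷ : ∀ {n a} (q : Point n) (p : Fin a → Point n) → AffinelyIndependent p →
  (∀ μ → sumFin μ ≡ 0ℚ → (∀ v → combination μ (q Vector.∷ p) v ≡ 0ℚ) → μ zero ≡ 0ℚ) →
  AffinelyIndependent (q Vector.∷ p)
affinelyIndependent-∷ q p indep head≡0 μ Σμ≡0 μqp≡0 zero    = head≡0 μ Σμ≡0 μqp≡0
affinelyIndependent-∷ q p indep head≡0 μ Σμ≡0 μqp≡0 (suc j) =
  indep (μ ∘ suc) (drop-head μ₀≡0 Σμ≡0)
        (λ v → drop-head (trans (cong (_* q v) μ₀≡0) (ℚₚ.*-zeroˡ (q v))) (μqp≡0 v)) j
  where
  μ₀≡0 = head≡0 μ Σμ≡0 μqp≡0
  drop-head : ∀ {x y} → x ≡ 0ℚ → x + y ≡ 0ℚ → y ≡ 0ℚ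
  drop-head {y = y} refl x+y≡0 = trans (sym (ℚₚ.+-identityˡ y)) x+y≡0

affinelyIndependent-∷-fresh : ∀ {n a} (q : Point n) (p : Fin a → Point n) (v : Fin n) →
  AffinelyIndependent p → q v ≢ 0ℚ → (∀ j → p j v ≡ 0ℚ) → AffinelyIndependent (q Vector.∷ p)
affinelyIndependent-∷-fresh q p v indep q[v]≢0 p[v]≡0 = affinelyIndependent-∷ q p indep
  λ μ _ μqp≡0 → p*q≡0⇒p≡0 q[v]≢0 (begin
    μ zero * q v                   ≡⟨ ℚₚ.+-identityʳ _ ⟨
    μ zero * q v + 0ℚ              ≡⟨ cong (μ zero * q v +_) (sumFin-zero (λ j →
                                        trans (cong (μ (suc j) *_) (p[v]≡0 j)) (ℚₚ.*-zeroʳ (μ (suc j))))) ⟨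
    combination μ (q Vector.∷ p) v ≡⟨ μqp≡0 v ⟩
    0ℚ                             ∎)

affinelyIndependent-∷-offHyperplane : ∀ {n a} (q : Point n) (p : Fin a → Point n) (S : Subset n) →
  AffinelyIndependent p → xsum q S ≡ 0ℚ → (∀ j → xsum (p j) S ≡ 1ℚ) → AffinelyIndependent (q Vector.∷ p)
affinelyIndependent-∷-offHyperplane q p S indep q[S]≡0 p[S]≡1 = affinelyIndependent-∷ q p indep
  λ μ Σμ≡0 μqp≡0 → begin
    μ zero                    ≡⟨ ℚₚ.+-identityʳ _ ⟨
    μ zero + 0ℚ               ≡⟨ cong (μ zero +_) (Σtail≡0 μ μqp≡0) ⟨
    μ zero + sumFin (μ ∘ suc) ≡⟨ Σμ≡0 ⟩
    0ℚ                        ∎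
  where
  Σtail≡0 : ∀ μ → (∀ v → combination μ (q Vector.∷ p) v ≡ 0ℚ) → sumFin (μ ∘ suc) ≡ 0ℚ
  Σtail≡0 μ μqp≡0 = begin
    sumFin (μ ∘ suc)                                       ≡⟨ sumFin-cong (λ j →
      trans (sym (ℚₚ.*-identityʳ (μ (suc j)))) (cong (μ (suc j) *_) (sym (p[S]≡1 j)))) ⟩
    sumFin (λ j → μ (suc j) * xsum (p j) S)                ≡⟨ ℚₚ.+-identityˡ _ ⟨
    0ℚ + sumFin (λ j → μ (suc j) * xsum (p j) S)           ≡⟨ cong (_+ sumFin (λ j → μ (suc j) * xsum (p j) S))
      (trans (cong (μ zero *_) q[S]≡0) (ℚₚ.*-zeroʳ (μ zero))) ⟨
    sumFin (λ j → μ j * xsum ((q Vector.∷ p) j) S)         ≡⟨ xsum-combination μ (q Vector.∷ p) S ⟨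
    xsum (combination μ (q Vector.∷ p)) S                  ≡⟨ xsum-zero S μqp≡0 ⟩
    0ℚ                                                     ∎

affinelyIndependent-witnessed : ∀ {n m} (p : Fin m → Point n) (u : Fin m → Fin n) →
  (∀ i → p i (u i) ≡ 1ℚ) → (∀ i j → j ≢ i → p j (u i) ≡ 0ℚ) → AffinelyIndependent p
affinelyIndependent-witnessed p u p[u]≡1 p[u]≡0 μ _ μp≡0 i = begin
  μ i                  ≡⟨ ℚₚ.*-identityʳ (μ i) ⟨
  μ i * 1ℚ             ≡⟨ cong (μ i *_) (p[u]≡1 i) ⟨
  μ i * p i (u i)      ≡⟨ sumFin-single i _ (λ j j≢i →
                            trans (cong (μ j *_) (p[u]≡0 i j j≢i)) (ℚₚ.*-zeroʳ (μ j))) ⟨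
  combination μ p (u i) ≡⟨ μp≡0 (u i) ⟩
  0ℚ                   ∎

-- Each new point q w is the only one so far that is nonzero at its own coordinate w.
affinelyIndependent-extend :
  ∀ {n a} (Q : Point n → Set) N (f : Fin n → Bool) → count f ≡ N →
  (q : ∀ w → f w ≡ true → Point n) →
  (∀ w fw → Q (q w fw) × q w fw w ≢ 0ℚ × (∀ v → f v ≡ true → v ≢ w → q w fw v ≡ 0ℚ)) →
  (p : Fin a → Point n) → (∀ j → Q (p j) × (∀ v → f v ≡ true → p j v ≡ 0ℚ)) → AffinelyIndependent p →
  Σ (Fin (N ℕ.+ a) → Point n) λ r → (∀ j → Q (r j)) × AffinelyIndependent r
affinelyIndependent-extend Q zero f _ _ _ p p-ok indep = p , proj₁ ∘ p-ok , indep
affinelyIndependent-extend {n} {a} Q (suc N) f |f|≡1+N q q-ok p p-ok indep =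
  Product.uncurry extendAt (0<count⇒∃ f (subst (0 <_) (sym |f|≡1+N) (s≤s z≤n)))
  where
  extendAt : ∀ w → f w ≡ true → Σ (Fin (suc N ℕ.+ a) → Point n) λ r → (∀ j → Q (r j)) × AffinelyIndependent r
  extendAt w fw =
    let r , Q′r , indep-r = affinelyIndependent-extend Q′ N (f without w) |f-w|≡N q′ q′-ok p p′-ok indep
    in  q w fw Vector.∷ r , Q-∷ r Q′r ,
        affinelyIndependent-∷-fresh (q w fw) r w indep-r (proj₁ (proj₂ (q-ok w fw))) (proj₂ ∘ Q′r)
    where
    Q′ : Point n → Set
    Q′ x = Q x × x w ≡ 0ℚ
    |f-w|≡N : count (f without w) ≡ N
    |f-w|≡N = ℕₚ.suc-injective (trans (count-without f fw) |f|≡1+N)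
    q′ : ∀ w′ → (f without w) w′ ≡ true → Point n
    q′ w′ f′w′ = q w′ (without-⊆ f f′w′)
    q′-ok : ∀ w′ f′w′ → Q′ (q′ w′ f′w′) × q′ w′ f′w′ w′ ≢ 0ℚ ×
                        (∀ v → (f without w) v ≡ true → v ≢ w′ → q′ w′ f′w′ v ≡ 0ℚ)
    q′-ok w′ f′w′ =
      let Qq , q≢0 , q≡0 = q-ok w′ (without-⊆ f f′w′)
      in  (Qq , q≡0 w fw (≢-sym (without-≢ f f′w′))) , q≢0 , λ v f′v → q≡0 v (without-⊆ f f′v)
    p′-ok : ∀ j → Q′ (p j) × (∀ v → (f without w) v ≡ true → p j v ≡ 0ℚ)
    p′-ok j = (proj₁ (p-ok j) , proj₂ (p-ok j) w fw) , λ v f′v → proj₂ (p-ok j) v (without-⊆ f f′v)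
    Q-∷ : ∀ r → (∀ j → Q′ (r j)) → ∀ j → Q ((q w fw Vector.∷ r) j)
    Q-∷ r Q′r zero    = proj₁ (q-ok w fw)
    Q-∷ r Q′r (suc j) = proj₁ (Q′r j)

-- Unions of hyperedges

lookup-∪ : ∀ {n} (p q : Subset n) v → lookup (p ∪ q) v ≡ lookup p v ∨ lookup q v
lookup-∪ p q v = Vecₚ.lookup-zipWith _∨_ v p q

lookup-⋃⁺ : ∀ {n} {Xs : List (Subset n)} {X v} → X ∈ₗ Xs → lookup X v ≡ true → lookup (⋃ Xs) v ≡ true
lookup-⋃⁺ {Xs = Y ∷ Ys} {v = v} (here refl) Yv
  rewrite lookup-∪ Y (⋃ Ys) v | Yv = refl
lookup-⋃⁺ {Xs = Y ∷ Ys} {v = v} (there X∈Ys) Xv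
  rewrite lookup-∪ Y (⋃ Ys) v | lookup-⋃⁺ X∈Ys Xv = Boolₚ.∨-zeroʳ (lookup Y v)

lookup-⋃⁻ : ∀ {n} {Xs : List (Subset n)} {v} → lookup (⋃ Xs) v ≡ true →
            ∃ λ X → X ∈ₗ Xs × lookup X v ≡ true
lookup-⋃⁻ {Xs = []} {v} ⊥v with () ← trans (sym ⊥v) (Vecₚ.lookup-replicate v false)
lookup-⋃⁻ {Xs = Y ∷ Ys} {v} ⋃v with lookup Y v in Yv
... | true  = Y , here refl , Yv
... | false = Product.map₂ (Product.map₁ there)
                (lookup-⋃⁻ (trans (sym (trans (lookup-∪ Y (⋃ Ys) v) (cong (_∨ _) Yv))) ⋃v))

module _ {n} (W : ℕ → Subset n) where

  ∈-Wunion⁺ : ∀ {s i v} → i < s → lookup (W (suc i)) v ≡ true → lookup (Wunion W s) v ≡ true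
  ∈-Wunion⁺ i<s = lookup-⋃⁺ (∈-applyUpTo⁺ (W ∘ suc) i<s)

  ∈-Wunion⁻ : ∀ {s v} → lookup (Wunion W s) v ≡ true → ∃ λ i → i < s × lookup (W (suc i)) v ≡ true
  ∈-Wunion⁻ ⋃v with lookup-⋃⁻ ⋃v
  ... | X , X∈ , Xv with ∈-applyUpTo⁻ (W ∘ suc) X∈
  ... | i , i<s , refl = i , i<s , Xv

  newVertex : ∀ {i} → ∣ Wunion W i ∣ < ∣ Wunion W (suc i) ∣ →
              ∃ λ v → lookup (W (suc i)) v ≡ true × lookup (Wunion W i) v ≡ false
  newVertex {i} grows
    with count<count⇒∃ (lookup (Wunion W i)) (lookup (Wunion W (suc i)))
                       (subst₂ _<_ (∣∣≡count (Wunion W i)) (∣∣≡count (Wunion W (suc i))) grows)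
  ... | v , new , old with ∈-Wunion⁻ new
  ... | j , j<1+i , W[1+j]v with ℕₚ.m≤n⇒m<n∨m≡n (ℕₚ.≤-pred j<1+i)
  ... | inj₁ j<i  = ⊥-elim (true≢false (trans (sym (∈-Wunion⁺ j<i W[1+j]v)) old))
  ... | inj₂ refl = v , W[1+j]v , old

∣p∣≡1+∣p-x∣ : ∀ {n} {p : Subset n} {x} → x ∈ p → ∣ p ∣ ≡ suc ∣ p - x ∣
∣p∣≡1+∣p-x∣ {p = true ∷ p}  here        = cong suc (cong ∣_∣ (sym (Subsetₚ.p─⊥≡p p)))
∣p∣≡1+∣p-x∣ {p = true ∷ p}  (there x∈p) = cong suc (∣p∣≡1+∣p-x∣ x∈p)
∣p∣≡1+∣p-x∣ {p = false ∷ p} (there x∈p) = ∣p∣≡1+∣p-x∣ x∈p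

StrongHypertree-size : ∀ {n k} {V : Subset n} {Ws} → StrongHypertree k V Ws →
                       (∀ X → X ∈ₗ Ws → ∣ X ∣ ≡ k) → ∣ V ∣ ℕ.+ 1 ≡ k ℕ.+ length Ws
StrongHypertree-size (single V) uniform = cong (ℕ._+ 1) (uniform V (here refl))
StrongHypertree-size {k = k} (step V Ws v Wi Ws′ Ws↭ v∈V _ _ T) uniform = begin
  ∣ V ∣ ℕ.+ 1             ≡⟨ cong (ℕ._+ 1) (∣p∣≡1+∣p-x∣ v∈V) ⟩
  suc ∣ V - v ∣ ℕ.+ 1     ≡⟨ cong suc (StrongHypertree-size T (λ X X∈ →
                               uniform X (∈-resp-↭ (↭-sym Ws↭) (there X∈)))) ⟩
  suc (k ℕ.+ length Ws′)  ≡⟨ ℕₚ.+-suc k _ ⟨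
  k ℕ.+ length (Wi ∷ Ws′) ≡⟨ cong (k ℕ.+_) (↭-length Ws↭) ⟨
  k ℕ.+ length Ws         ∎

NewVertices : ∀ {n s} → (ℕ → Subset n) → (Fin s → Fin n) → Set
NewVertices W w = ∀ i → lookup (W (suc (toℕ i))) (w i) ≡ true × lookup (Wunion W (toℕ i)) (w i) ≡ false

newVertices : ∀ {n} (W : ℕ → Subset n) s → (∀ i → i < s → ∣ Wunion W i ∣ < ∣ Wunion W (suc i) ∣) →
              Σ (Fin s → Fin n) (NewVertices W)
newVertices W s grows = proj₁ ∘ new , proj₂ ∘ new
  where
  new : ∀ (i : Fin s) → ∃ λ v → lookup (W (suc (toℕ i))) v ≡ true × lookup (Wunion W (toℕ i)) v ≡ false
  new i = newVertex W (grows (toℕ i) (Finₚ.toℕ<n i))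

module _ {n s} (W : ℕ → Subset n) {w : Fin s → Fin n} (new : NewVertices W w) where

  isNew : Fin n → Bool
  isNew v = does (Finₚ.any? (λ i → w i ≟ v))

  new-distinct : ∀ {i j} → toℕ i < toℕ j → w i ≢ w j
  new-distinct {i} {j} i<j wi≡wj =
    true≢false (trans (sym (∈-Wunion⁺ W i<j (proj₁ (new i))))
                      (trans (cong (lookup (Wunion W (toℕ j))) wi≡wj) (proj₂ (new j))))

  new-injective : ∀ i j → w i ≡ w j → i ≡ j
  new-injective i j wi≡wj with Finₚ.<-cmp i j
  ... | tri< i<j _ _ = ⊥-elim (new-distinct i<j wi≡wj)
  ... | tri≈ _ i≡j _ = i≡j
  ... | tri> _ _ j<i = ⊥-elim (new-distinct j<i (sym wi≡wj))

  s≤count-isNew : s ≤ count isNew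
  s≤count-isNew = subst (_≤ count isNew) (count-true s)
    (count-injective (λ _ → true) w isNew (λ i _ → dec-true (Finₚ.any? (λ j → w j ≟ w i)) (i , refl))
                     (λ i j _ _ → new-injective i j))

  -- By strong induction on i: the only vertex of W (1 + i) at which M is not yet known
  -- to vanish is w i, since later new vertices lie outside W (1 + i).
  new≡0 : (M : Point n) → (∀ i → xsum M (W (suc (toℕ i))) ≡ 0ℚ) →
          (∀ v → isNew v ≡ false → M v ≡ 0ℚ) → ∀ i → M (w i) ≡ 0ℚ
  new≡0 M M[W]≡0 M[old]≡0 = All.wfRec Finᵢ.<-wellFounded 0ℓ (λ i → M (w i) ≡ 0ℚ) from-earlier
    where
    from-earlier : ∀ i → (∀ {j} → j Fin.< i → M (w j) ≡ 0ℚ) → M (w i) ≡ 0ℚ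
    from-earlier i IH = begin
      M (w i)                                                  ≡⟨ cong (if_then M (w i) else 0ℚ) (proj₁ (new i)) ⟨
      (if lookup (W (suc (toℕ i))) (w i) then M (w i) else 0ℚ) ≡⟨ sumFin-single (w i) _ others ⟨
      xsum M (W (suc (toℕ i)))                                 ≡⟨ M[W]≡0 i ⟩
      0ℚ                                                       ∎
      where
      others : ∀ u → u ≢ w i → (if lookup (W (suc (toℕ i))) u then M u else 0ℚ) ≡ 0ℚ
      others u u≢wi with lookup (W (suc (toℕ i))) u in Wu
      ... | false = refl
      ... | true with Finₚ.any? (λ j → w j ≟ u)
      ...   | no ¬new = M[old]≡0 u (dec-false (Finₚ.any? (λ j → w j ≟ u)) ¬new)
      ...   | yes (j , refl) with Finₚ.<-cmp j i
      ...     | tri< j<i _ _  = IH j<i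
      ...     | tri≈ _ refl _ = ⊥-elim (u≢wi refl)
      ...     | tri> _ _ i<j  = ⊥-elim (true≢false (trans (sym (∈-Wunion⁺ W i<j Wu)) (proj₂ (new j))))

  old≡0⇒≡0 : (M : Point n) → (∀ i → xsum M (W (suc (toℕ i))) ≡ 0ℚ) →
             (∀ v → isNew v ≡ false → M v ≡ 0ℚ) → ∀ v → M v ≡ 0ℚ
  old≡0⇒≡0 M M[W]≡0 M[old]≡0 v with Finₚ.any? (λ i → w i ≟ v)
  ... | yes (i , refl) = new≡0 M M[W]≡0 M[old]≡0 i
  ... | no ¬new        = M[old]≡0 v (dec-false (Finₚ.any? (λ i → w i ≟ v)) ¬new)

  affinelyIndependent-bound-new : ∀ {m} (p : Fin m → Point n) → AffinelyIndependent p →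
                                  (∀ j i → xsum (p j) (W (suc (toℕ i))) ≡ 1ℚ) → m ℕ.+ s ≤ suc n
  affinelyIndependent-bound-new {m} p indep p[W]≡1 = ℕₚ.≤-trans
    (ℕₚ.+-mono-≤ (affinelyIndependent-bound (not ∘ isNew) p indep determined) s≤count-isNew)
    (ℕₚ.≤-reflexive (cong suc (trans (ℕₚ.+-comm _ (count isNew)) (count-complement isNew))))
    where
    determined : ∀ μ → sumFin μ ≡ 0ℚ → (∀ v → not (isNew v) ≡ true → combination μ p v ≡ 0ℚ) →
                 ∀ v → combination μ p v ≡ 0ℚ
    determined μ Σμ≡0 μp[old]≡0 = old≡0⇒≡0 (combination μ p)
      (λ i → trans (xsum-combination μ p (W (suc (toℕ i))))
             (trans (sumFin-cong (λ j → trans (cong (μ j *_) (p[W]≡1 j i)) (ℚₚ.*-identityʳ (μ j)))) Σμ≡0))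
      (λ v old → μp[old]≡0 v (cong not old))

-- Stable sets and clique projections

Stable : ∀ {n} → Graph n → (Fin n → Bool) → Set
Stable {n} H f = ∀ (u v : Fin n) → f u ≡ true → f v ≡ true → H u v ≡ false

lookup⇒∈ : ∀ {n} {S : Subset n} {v} → lookup S v ≡ true → v ∈ S
lookup⇒∈ {S = S} {v} = Vecₚ.lookup⇒[]= v S

IsStable⇒Stable : ∀ {n} {H : Graph n} {S} → IsStable H S → Stable H (lookup S)
IsStable⇒Stable stable u v Su Sv = stable u v (lookup⇒∈ Su) (lookup⇒∈ Sv)

stable-clique : ∀ {n} {H : Graph n} {f W} → Stable H f → IsClique H W →
                (∀ u → lookup W u ≡ true → f u ≡ false) ⊎ MeetsOnce f W
stable-clique {H = H} {f} {W} stable clique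
  with Finₚ.any? (λ u → (lookup W u Boolₚ.≟ true) ×-dec (f u Boolₚ.≟ true))
... | yes (u , Wu , fu) = inj₂ (u , Wu , fu , unique)
  where
  unique : ∀ u′ → lookup W u′ ≡ true → f u′ ≡ true → u′ ≡ u
  unique u′ Wu′ fu′ with u′ ≟ u
  ... | yes u′≡u = u′≡u
  ... | no u′≢u  = ⊥-elim (true≢false
    (trans (sym (clique u′ u (lookup⇒∈ Wu′) (lookup⇒∈ Wu) u′≢u)) (stable u′ u fu′ fu)))
... | no ¬meet = inj₁ (λ u Wu → Boolₚ.¬-not (λ fu → ¬meet (u , Wu , fu)))

allFinB⇒ : ∀ {n} (p : Fin n → Bool) → allFinB p ≡ true → ∀ w → p w ≡ true
allFinB⇒ {suc n} p all w with p zero in p₀ | w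
... | true  | zero  = p₀
... | true  | suc u = allFinB⇒ (p ∘ suc) all u

allFinB-cong : ∀ {n} {p q : Fin n → Bool} → (∀ w → p w ≡ q w) → allFinB p ≡ allFinB q
allFinB-cong {zero}  p≗q = refl
allFinB-cong {suc n} p≗q = cong₂ _∧_ (p≗q zero) (allFinB-cong (p≗q ∘ suc))

module _ {n} (H : Graph n) (W : Subset n) where

  ∣ₚ-⊇ : ∀ {u v} → H u v ≡ true → (H ∣ₚ W) u v ≡ true
  ∣ₚ-⊇ Huv rewrite Huv = refl

  ∣ₚ-sym : (∀ u v → H u v ≡ H v u) → ∀ u v → (H ∣ₚ W) u v ≡ (H ∣ₚ W) v u
  ∣ₚ-sym sym-H u v = cong₂ _∨_ (sym-H u v) (cong₂ _∧_ (cong not (≟-sym u v))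
    (allFinB-cong (λ w → cong (not (lookup W w) ∨_) (Boolₚ.∨-comm (H u w) (H v w)))))
    where
    ≟-sym : ∀ u v → does (u ≟ v) ≡ does (v ≟ u)
    ≟-sym u v with u ≟ v
    ... | yes refl = sym (dec-true (u ≟ u) refl)
    ... | no u≢v  = sym (dec-false (v ≟ u) (≢-sym u≢v))

  ∣ₚ-irrefl : (∀ u → H u u ≡ false) → ∀ u → (H ∣ₚ W) u u ≡ false
  ∣ₚ-irrefl irrefl u rewrite irrefl u | dec-true (u ≟ u) refl = refl

  -- An edge uv added by the projection has W ⊆ N(u) ∪ N(v), so one of u, v sees
  -- the vertex the stable set has in W.
  stable-∣ₚ : ∀ {f u₀} → Stable H f → lookup W u₀ ≡ true → f u₀ ≡ true → Stable (H ∣ₚ W) f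
  stable-∣ₚ {f} {u₀} stable Wu₀ fu₀ u v fu fv rewrite stable u v fu fv with coveredB H W u v in covered
  ... | false = Boolₚ.∧-zeroʳ _
  ... | true  = ⊥-elim (true≢false (trans (sym (allFinB⇒ _ covered u₀)) uncovered))
    where
    uncovered : (not (lookup W u₀) ∨ H u u₀ ∨ H v u₀) ≡ false
    uncovered rewrite Wu₀ | stable u u₀ fu fu₀ | stable v u₀ fv fu₀ = refl

module _ {n} (G : Graph n) (W : ℕ → Subset n) where

  Gseq-mono : ∀ {s s′} → s ≤ s′ → ∀ {u v} → Gseq G W s u v ≡ true → Gseq G W s′ u v ≡ true
  Gseq-mono {s′ = zero}       z≤n     = λ e → e
  Gseq-mono {s} {s′ = suc s′} s≤1+s′ with ℕₚ.m≤n⇒m<n∨m≡n s≤1+s′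
  ... | inj₁ s<1+s′ = ∣ₚ-⊇ (Gseq G W s′) (W (suc s′)) ∘ Gseq-mono (ℕₚ.≤-pred s<1+s′)
  ... | inj₂ refl   = λ e → e

  Gseq-sym : (∀ u v → G u v ≡ G v u) → ∀ s u v → Gseq G W s u v ≡ Gseq G W s v u
  Gseq-sym sym-G zero    = sym-G
  Gseq-sym sym-G (suc s) = ∣ₚ-sym (Gseq G W s) (W (suc s)) (Gseq-sym sym-G s)

  Gseq-irrefl : (∀ u → G u u ≡ false) → ∀ s u → Gseq G W s u u ≡ false
  Gseq-irrefl irrefl zero    = irrefl
  Gseq-irrefl irrefl (suc s) = ∣ₚ-irrefl (Gseq G W s) (W (suc s)) (Gseq-irrefl irrefl s)

stable-⊆ : ∀ {n} {H H′ : Graph n} {f} → (∀ {u v} → H u v ≡ true → H′ u v ≡ true) →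
           Stable H′ f → Stable H f
stable-⊆ {H = H} H⊆H′ stable u v fu fv with H u v in Huv
... | false = refl
... | true  = ⊥-elim (true≢false (trans (sym (H⊆H′ Huv)) (stable u v fu fv)))

-- The stable set polytope

indicator∈STAB : ∀ {n} {H : Graph n} {f} → Stable H f → STAB H (indicator f)
indicator∈STAB {H = H} {f} stable = (1ℚ , tabulate f) ∷ [] , valid , ℚₚ.+-identityʳ 1ℚ , indicator≡
  where
  f≡ : ∀ v → f v ≡ lookup (tabulate f) v
  f≡ v = sym (Vecₚ.lookup∘tabulate f v)
  valid : ∀ {l S} → (l , S) ∈ₗ ((1ℚ , tabulate f) ∷ []) → 0ℚ ℚ.≤ l × IsStable H S
  valid (here refl) = ℚₚ.nonNegative⁻¹ 1ℚ , λ u v u∈ v∈ →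
    stable u v (trans (f≡ u) (Vecₚ.[]=⇒lookup u∈)) (trans (f≡ v) (Vecₚ.[]=⇒lookup v∈))
  indicator≡ : ∀ v → indicator f v ≡ 1ℚ * χ (tabulate f) v + 0ℚ
  indicator≡ v = begin
    indicator f v                ≡⟨ cong (if_then 1ℚ else 0ℚ) (f≡ v) ⟩
    χ (tabulate f) v             ≡⟨ ℚₚ.*-identityˡ _ ⟨
    1ℚ * χ (tabulate f) v        ≡⟨ ℚₚ.+-identityʳ _ ⟨
    1ℚ * χ (tabulate f) v + 0ℚ   ∎

weighted-clique≤ : ∀ {n} {H : Graph n} {S W : Subset n} {l} → 0ℚ ℚ.≤ l → IsStable H S → IsClique H W →
                   l * xsum (χ S) W ℚ.≤ l
weighted-clique≤ {S = S} {W} {l} 0≤l stable clique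
  with stable-clique {f = lookup S} (IsStable⇒Stable stable) clique
... | inj₁ disjoint = subst (ℚ._≤ l)
  (sym (trans (cong (l *_) (xsum-indicator-disjoint {W = W} disjoint)) (ℚₚ.*-zeroʳ l))) 0≤l
... | inj₂ once     = ℚₚ.≤-reflexive (trans (cong (l *_) (xsum-indicator-once {W = W} once)) (ℚₚ.*-identityʳ l))

xsum-convex : ∀ {n} {x : Point n} (cs : List (ℚ × Subset n)) (S : Subset n) →
              (∀ v → x v ≡ sumList (map (λ c → proj₁ c * χ (proj₂ c) v) cs)) →
              xsum x S ≡ sumList (map (λ c → proj₁ c * xsum (χ (proj₂ c)) S) cs)
xsum-convex cs S x≡ = trans (xsum-cong S x≡) (go cs)
  where
  go : ∀ cs → xsum (λ v → sumList (map (λ c → proj₁ c * χ (proj₂ c) v) cs)) S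
            ≡ sumList (map (λ c → proj₁ c * xsum (χ (proj₂ c)) S) cs)
  go []             = xsum-zero S (λ _ → refl)
  go ((l , T) ∷ cs) = trans (xsum-+ (λ v → l * χ T v) _ S) (cong₂ _+_ (xsum-*ˡ l (χ T) S) (go cs))

clique-inequality : ∀ {n} {H : Graph n} {W : Subset n} {x} → IsClique H W → STAB H x → xsum x W ℚ.≤ 1ℚ
clique-inequality {W = W} clique (cs , valid , Σl≡1 , x≡) =
  subst₂ ℚ._≤_ (sym (xsum-convex cs W x≡)) Σl≡1
    (sumList-mono _ proj₁ cs (λ c c∈ → weighted-clique≤ (proj₁ (valid c∈)) (proj₂ (valid c∈)) clique))

-- Tightness of x_W ≤ 1 forces every stable set of positive weight to meet W, and such
-- sets stay stable in H ∣ₚ W; the sets of weight zero are replaced by the empty set.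
STAB-∣ₚ : ∀ {n} {H : Graph n} {W : Subset n} {x} → IsClique H W → STAB H x → xsum x W ≡ 1ℚ →
          STAB (H ∣ₚ W) x
STAB-∣ₚ {n} {H} {W} {x} clique (cs , valid , Σl≡1 , x≡) x[W]≡1 =
  map restrict cs , valid′ , trans (cong sumList (sym (Listₚ.map-∘ cs))) Σl≡1 , x≡′
  where
  restrict : ℚ × Subset n → ℚ × Subset n
  restrict (l , S) = l , (if does (l ℚₚ.≟ 0ℚ) then ⊥ else S)
  tight : ∀ {l S} → (l , S) ∈ₗ cs → l * xsum (χ S) W ≡ l
  tight c∈ = sumList-tight _ proj₁ cs
    (λ c c∈ → weighted-clique≤ (proj₁ (valid c∈)) (proj₂ (valid c∈)) clique)
    (trans (sym (xsum-convex cs W x≡)) (trans x[W]≡1 (sym Σl≡1))) _ c∈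
  valid′ : ∀ {l S′} → (l , S′) ∈ₗ map restrict cs → 0ℚ ℚ.≤ l × IsStable (H ∣ₚ W) S′
  valid′ c′∈ with ∈-map⁻ restrict c′∈
  ... | (l , S) , c∈ , refl with l ℚₚ.≟ 0ℚ
  ...   | yes _   = proj₁ (valid c∈) , λ u _ u∈⊥ _ → ⊥-elim (Subsetₚ.∉⊥ u∈⊥)
  ...   | no l≢0 with stable-clique {f = lookup S} (IsStable⇒Stable (proj₂ (valid c∈))) clique
  ...     | inj₁ disjoint = ⊥-elim (l≢0 (trans (sym (tight c∈))
                              (trans (cong (l *_) (xsum-indicator-disjoint {W = W} disjoint)) (ℚₚ.*-zeroʳ l))))
  ...     | inj₂ (u₀ , Wu₀ , Su₀ , _) = proj₁ (valid c∈) , λ u v u∈ v∈ →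
    stable-∣ₚ H W (IsStable⇒Stable (proj₂ (valid c∈))) Wu₀ Su₀ u v
              (Vecₚ.[]=⇒lookup u∈) (Vecₚ.[]=⇒lookup v∈)
  x≡′ : ∀ v → x v ≡ sumList (map (λ c → proj₁ c * χ (proj₂ c) v) (map restrict cs))
  x≡′ v = trans (x≡ v) (cong sumList (trans (Listₚ.map-cong same-term cs) (Listₚ.map-∘ cs)))
    where
    same-term : ∀ c → proj₁ c * χ (proj₂ c) v ≡ proj₁ (restrict c) * χ (proj₂ (restrict c)) v
    same-term (l , S) with l ℚₚ.≟ 0ℚ
    ... | yes refl = trans (ℚₚ.*-zeroˡ (χ S v)) (sym (ℚₚ.*-zeroˡ (χ ⊥ v)))
    ... | no _     = refl

Fface⊆STAB : ∀ {n} (G : Graph n) (W : ℕ → Subset n) s →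
             (∀ j → 1 ≤ j → j ≤ s → IsClique (Gseq G W (j ∸ 1)) (W j)) →
             ∀ {x} → Fface G W s x → STAB (Gseq G W s) x
Fface⊆STAB G W zero    _       (x∈STAB , _)      = x∈STAB
Fface⊆STAB G W (suc s) cliques (x∈STAB , x[W]≡1) =
  STAB-∣ₚ (cliques (suc s) (s≤s z≤n) ℕₚ.≤-refl)
          (Fface⊆STAB G W s (λ j 1≤j j≤s → cliques j 1≤j (ℕₚ.m≤n⇒m≤1+n j≤s))
                      (x∈STAB , λ j 1≤j j≤s → x[W]≡1 j 1≤j (ℕₚ.m≤n⇒m≤1+n j≤s)))
          (x[W]≡1 (suc s) (s≤s z≤n) ℕₚ.≤-refl)

from1-based : ∀ {P : ℕ → Set} {s} → (∀ i → i < s → P (suc i)) → ∀ j → 1 ≤ j → j ≤ s → P j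
from1-based h (suc i) _ 1+i≤s = h i 1+i≤s

module FfaceProperties {n} (G : Graph n) (W : ℕ → Subset n) where

  Fface-equations : ∀ {s x} → Fface G W s x → ∀ (i : Fin s) → xsum x (W (suc (toℕ i))) ≡ 1ℚ
  Fface-equations (_ , x[W]≡1) i = x[W]≡1 (suc (toℕ i)) (s≤s z≤n) (Finₚ.toℕ<n i)

  Fface-suc⁺ : ∀ {s x} → Fface G W s x → xsum x (W (suc s)) ≡ 1ℚ → Fface G W (suc s) x
  Fface-suc⁺ {s} {x} (x∈STAB , x[W]≡1) x[Wₜ]≡1 = x∈STAB , equations
    where
    equations : ∀ j → 1 ≤ j → j ≤ suc s → xsum x (W j) ≡ 1ℚ
    equations j 1≤j j≤1+s with ℕₚ.m≤n⇒m<n∨m≡n j≤1+s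
    ... | inj₁ j<1+s = x[W]≡1 j 1≤j (ℕₚ.≤-pred j<1+s)
    ... | inj₂ refl  = x[Wₜ]≡1

  Fface-suc⁻ : ∀ {s x} → Fface G W (suc s) x → Fface G W s x × xsum x (W (suc s)) ≡ 1ℚ
  Fface-suc⁻ (x∈STAB , x[W]≡1) =
    (x∈STAB , λ j 1≤j j≤s → x[W]≡1 j 1≤j (ℕₚ.m≤n⇒m≤1+n j≤s)) , x[W]≡1 _ (s≤s z≤n) ℕₚ.≤-refl

  indicator∈Fface : ∀ {s s′ f} → Stable (Gseq G W s) f → (∀ i → i < s′ → MeetsOnce f (W (suc i))) →
                    Fface G W s′ (indicator f)
  indicator∈Fface {s} stable meets =
    indicator∈STAB (stable-⊆ (Gseq-mono G W {s′ = s} z≤n) stable) ,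
    from1-based (λ i i<s′ → xsum-indicator-once {W = W (suc i)} (meets i i<s′))

  Fface-bound : ∀ {s} {w : Fin s → Fin n} → NewVertices W w → ∀ {m} (p : Fin m → Point n) →
                (∀ j → Fface G W s (p j)) → AffinelyIndependent p → m ℕ.+ s ≤ suc n
  Fface-bound new p p∈F indep = affinelyIndependent-bound-new W new p indep (λ j → Fface-equations (p∈F j))

-- The facet

Conditions : ∀ {n} → Graph n → (ℕ → Subset n) → ℕ → ℕ → Set
Conditions {n} G W r k = ∀ (t : ℕ) → 1 ≤ t → t ≤ r →
  ∣ W t ∣ ≡ k ×
  Σ (Fin n → Fin k) λ col →
    (∀ (u v : Fin n) → u ∈ Wunion W t → v ∈ Wunion W t → Gseq G W (t ∸ 1) u v ≡ true → col u ≢ col v) ×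
    StrongHypertree k (Wunion W t) (Wlist W t) ×
    (∀ (w : Fin n) → w ∉ Wunion W t →
       Σ (Fin k) λ i → ∀ (v : Fin n) → v ∈ Wunion W t → col v ≡ i → Gseq G W (t ∸ 1) w v ≡ false)

module FacetProof {n} (G : Graph n) (simple : IsSimpleGraph G) (r : ℕ) (W : ℕ → Subset n)
  (cliques : ∀ (t : ℕ) → 1 ≤ t → t ≤ r → IsClique (Gseq G W (t ∸ 1)) (W t) × 2 ≤ ∣ W t ∣)
  (k : ℕ) (k>0 : 0 < k) (conditions : Conditions G W r k) (s : ℕ) (t≤r : suc s ≤ r) where

  open FfaceProperties G W

  t : ℕ
  t = suc s

  H : Graph n
  H = Gseq G W s

  -- V_t of the paper; class c below is its colour class V_t^c.
  U : Fin n → Bool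
  U = lookup (Wunion W t)

  Wunion-size : ∀ i → suc i ≤ r → ∣ Wunion W (suc i) ∣ ≡ k ℕ.+ i
  Wunion-size i 1+i≤r = ℕₚ.+-cancelʳ-≡ 1 _ _ (begin
    ∣ Wunion W (suc i) ∣ ℕ.+ 1      ≡⟨ StrongHypertree-size hypertree uniform ⟩
    k ℕ.+ length (Wlist W (suc i))  ≡⟨ cong (k ℕ.+_) (Listₚ.length-applyUpTo (W ∘ suc) (suc i)) ⟩
    k ℕ.+ suc i                     ≡⟨ ℕₚ.+-suc k i ⟩
    suc (k ℕ.+ i)                   ≡⟨ ℕₚ.+-comm 1 (k ℕ.+ i) ⟩
    k ℕ.+ i ℕ.+ 1                   ∎)
    where
    hypertree : StrongHypertree k (Wunion W (suc i)) (Wlist W (suc i))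
    hypertree = proj₁ (proj₂ (proj₂ (proj₂ (conditions (suc i) (s≤s z≤n) 1+i≤r))))
    uniform : ∀ X → X ∈ₗ Wlist W (suc i) → ∣ X ∣ ≡ k
    uniform X X∈ with ∈-applyUpTo⁻ (W ∘ suc) X∈
    ... | j , j<1+i , refl = proj₁ (conditions (suc j) (s≤s z≤n) (ℕₚ.≤-trans j<1+i 1+i≤r))

  Wunion-grows : ∀ i → i < r → ∣ Wunion W i ∣ < ∣ Wunion W (suc i) ∣
  Wunion-grows zero    0<r   =
    subst₂ _<_ (sym (Subsetₚ.∣⊥∣≡0 n)) (sym (trans (Wunion-size 0 0<r) (ℕₚ.+-identityʳ k))) k>0
  Wunion-grows (suc i) 1+i<r =
    subst₂ _<_ (sym (Wunion-size i (ℕₚ.<⇒≤ 1+i<r))) (sym (Wunion-size (suc i) 1+i<r))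
               (ℕₚ.+-monoʳ-< k (ℕₚ.n<1+n i))

  newVerticesUpTo : ∀ {s′} → s′ ≤ r → Σ (Fin s′ → Fin n) (NewVertices W)
  newVerticesUpTo {s′} s′≤r = newVertices W s′ (λ i i<s′ → Wunion-grows i (ℕₚ.<-≤-trans i<s′ s′≤r))

  col : Fin n → Fin k
  col = proj₁ (proj₂ (conditions t (s≤s z≤n) t≤r))

  proper : ∀ {u v} → U u ≡ true → U v ≡ true → H u v ≡ true → col u ≢ col v
  proper {u} {v} Uu Uv = proj₁ (proj₂ (proj₂ (conditions t (s≤s z≤n) t≤r))) u v (lookup⇒∈ Uu) (lookup⇒∈ Uv)

  sparse : ∀ w → U w ≡ false → ∃ λ c → ∀ v → U v ≡ true → col v ≡ c → H w v ≡ false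
  sparse w out = Product.map₂ (λ h v Uv → h v (lookup⇒∈ Uv))
    (proj₂ (proj₂ (proj₂ (proj₂ (conditions t (s≤s z≤n) t≤r)))) w
      (λ w∈ → true≢false (trans (sym (Vecₚ.[]=⇒lookup w∈)) out)))

  clique : ∀ {i} → i < t → IsClique H (W (suc i))
  clique {i} i<t u v u∈ v∈ u≢v =
    Gseq-mono G W (ℕₚ.≤-pred i<t) (proj₁ (cliques (suc i) (s≤s z≤n) (ℕₚ.≤-trans i<t t≤r)) u v u∈ v∈ u≢v)

  W⊆U : ∀ {i v} → i < t → lookup (W (suc i)) v ≡ true → U v ≡ true
  W⊆U = ∈-Wunion⁺ W

  col-injective : ∀ {i} → i < t → ∀ u v → lookup (W (suc i)) u ≡ true → lookup (W (suc i)) v ≡ true →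
                  col u ≡ col v → u ≡ v
  col-injective i<t u v Wu Wv cu≡cv with u ≟ v
  ... | yes u≡v = u≡v
  ... | no u≢v  = ⊥-elim (proper (W⊆U i<t Wu) (W⊆U i<t Wv)
                                 (clique i<t u v (lookup⇒∈ Wu) (lookup⇒∈ Wv) u≢v) cu≡cv)

  rainbow : ∀ {i} → i < t → ∀ c → ∃ λ u → lookup (W (suc i)) u ≡ true × col u ≡ c
  rainbow {i} i<t = injective⇒onto (lookup (W (suc i))) col size (col-injective i<t)
    where
    size : count (lookup (W (suc i))) ≡ k
    size = trans (sym (∣∣≡count (W (suc i)))) (proj₁ (conditions (suc i) (s≤s z≤n) (ℕₚ.≤-trans i<t t≤r)))

  class : Fin k → Fin n → Bool
  class c v = U v ∧ does (col v ≟ c)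

  class⁺ : ∀ {c v} → U v ≡ true → col v ≡ c → class c v ≡ true
  class⁺ {v = v} Uv refl rewrite Uv = dec-true (col v ≟ col v) refl

  class⁻ : ∀ {c v} → class c v ≡ true → U v ≡ true × col v ≡ c
  class⁻ {v = v} cv = ∧-conicalˡ (U v) _ cv , does⇒≡ (∧-conicalʳ (U v) _ cv)

  class-outside : ∀ {c v} → U v ≡ false → class c v ≡ false
  class-outside Uv rewrite Uv = refl

  class-stable : ∀ c → Stable H (class c)
  class-stable c u v cu cv with H u v in Huv
  ... | false = refl
  ... | true  = ⊥-elim (proper (proj₁ (class⁻ cu)) (proj₁ (class⁻ cv)) Huv
                               (trans (proj₂ (class⁻ cu)) (sym (proj₂ (class⁻ cv)))))

  class-meets : ∀ {i} → i < t → ∀ c → MeetsOnce (class c) (W (suc i))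
  class-meets i<t c with rainbow i<t c
  ... | u , Wu , cu≡c = u , Wu , class⁺ (W⊆U i<t Wu) cu≡c ,
    λ u′ Wu′ cu′ → col-injective i<t u′ u Wu′ Wu (trans (proj₂ (class⁻ cu′)) (sym cu≡c))

  class∈F : ∀ c → Fface G W t (indicator (class c))
  class∈F c = indicator∈Fface {s = s} {f = class c} (class-stable c) (λ _ i<t → class-meets i<t c)

  classes-independent : AffinelyIndependent (indicator ∘ class)
  classes-independent = affinelyIndependent-witnessed (indicator ∘ class) (proj₁ ∘ rainbow₁) at-own at-other
    where
    rainbow₁ : ∀ c → ∃ λ u → lookup (W 1) u ≡ true × col u ≡ c
    rainbow₁ = rainbow (s≤s z≤n)
    at-own : ∀ c → indicator (class c) (proj₁ (rainbow₁ c)) ≡ 1ℚ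
    at-own c = indicator-true (class c)
      (class⁺ (W⊆U (s≤s z≤n) (proj₁ (proj₂ (rainbow₁ c)))) (proj₂ (proj₂ (rainbow₁ c))))
    at-other : ∀ c c′ → c′ ≢ c → indicator (class c′) (proj₁ (rainbow₁ c)) ≡ 0ℚ
    at-other c c′ c′≢c = indicator-false (class c′) (Boolₚ.¬-not (λ in-c′ →
      c′≢c (trans (sym (proj₂ (class⁻ in-c′))) (proj₂ (proj₂ (rainbow₁ c))))))

  module _ (w : Fin n) (out : U w ≡ false) where

    partner : Fin k
    partner = proj₁ (sparse w out)

    classWith : Fin n → Bool
    classWith v = class partner v ∨ does (v ≟ w)

    no-edge : ∀ v → class partner v ≡ true → H w v ≡ false
    no-edge v pv = proj₂ (sparse w out) v (proj₁ (class⁻ pv)) (proj₂ (class⁻ pv))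

    classWith-stable : Stable H classWith
    classWith-stable u v cu cv with class partner u in pu | class partner v in pv
    ... | true  | true  = class-stable partner u v pu pv
    ... | true  | false with refl ← does⇒≡ {a = v} {w} cv = trans (Gseq-sym G W (proj₁ simple) s u w) (no-edge u pu)
    ... | false | true  with refl ← does⇒≡ {a = u} {w} cu = no-edge v pv
    ... | false | false with refl ← does⇒≡ {a = u} {w} cu | refl ← does⇒≡ {a = v} {w} cv =
      Gseq-irrefl G W (proj₂ simple) s w

    classWith-meets : ∀ {i} → i < t → MeetsOnce classWith (W (suc i))
    classWith-meets {i} i<t = MeetsOnce-cong {W = W (suc i)} agrees (class-meets i<t partner)
      where
      agrees : ∀ u → lookup (W (suc i)) u ≡ true → class partner u ≡ classWith u
      agrees u Wu rewrite dec-false (u ≟ w) (λ u≡w → true≢false (trans (sym (W⊆U i<t Wu)) (trans (cong U u≡w) out))) =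
        sym (Boolₚ.∨-identityʳ _)

    classWith∈F : Fface G W t (indicator classWith)
    classWith∈F = indicator∈Fface {s = s} classWith-stable (λ _ → classWith-meets)

    classWith-self : classWith w ≡ true
    classWith-self rewrite dec-true (w ≟ w) refl = Boolₚ.∨-zeroʳ _

    classWith-outside : ∀ {v} → U v ≡ false → v ≢ w → classWith v ≡ false
    classWith-outside Uv v≢w rewrite class-outside {partner} Uv | dec-false (_ ≟ w) v≢w = refl

  outside : Fin n → Bool
  outside = not ∘ U

  outside⇒ : ∀ {w} → outside w ≡ true → U w ≡ false
  outside⇒ = Boolₚ.not-injective

  m : ℕ
  m = count outside ℕ.+ k

  -- The colour classes of U, and for every vertex w outside U the class without
  -- neighbours of w together with w.
  facePoints : Σ (Fin m → Point n) λ p → (∀ j → Fface G W t (p j)) × AffinelyIndependent p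
  facePoints = affinelyIndependent-extend (Fface G W t) (count outside) outside refl
    (λ w ow → indicator (classWith w (outside⇒ ow)))
    (λ w ow → let out = outside⇒ ow in
      classWith∈F w out ,
      (λ eq → ℚₚ.1≢0 (trans (sym (indicator-true (classWith w out) (classWith-self w out))) eq)) ,
      λ v ov v≢w → indicator-false (classWith w out) (classWith-outside w out (outside⇒ ov) v≢w))
    (indicator ∘ class)
    (λ c → class∈F c , λ v ov → indicator-false (class c) (class-outside {c} (outside⇒ ov)))
    classes-independent

  wₜ-new : ∃ λ w → lookup (W t) w ≡ true × lookup (Wunion W s) w ≡ false
  wₜ-new = newVertex W (Wunion-grows s t≤r)

  wₜ : Fin n
  wₜ = proj₁ wₜ-new

  shortClass : Fin n → Bool
  shortClass = class (col wₜ) without wₜ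

  shortClass-stable : Stable H shortClass
  shortClass-stable u v su sv = class-stable (col wₜ) u v (without-⊆ (class (col wₜ)) su) (without-⊆ (class (col wₜ)) sv)

  shortClass-meets : ∀ {i} → i < s → MeetsOnce shortClass (W (suc i))
  shortClass-meets {i} i<s = MeetsOnce-cong {W = W (suc i)} agrees (class-meets (ℕₚ.m<n⇒m<1+n i<s) (col wₜ))
    where
    agrees : ∀ u → lookup (W (suc i)) u ≡ true → class (col wₜ) u ≡ shortClass u
    agrees u Wu rewrite dec-false (u ≟ wₜ) (λ u≡wₜ →
        true≢false (trans (sym (∈-Wunion⁺ W i<s Wu))
                          (trans (cong (lookup (Wunion W s)) u≡wₜ) (proj₂ (proj₂ wₜ-new))))) =
      sym (∧-identityʳ _)

  shortClass-misses : ∀ u → lookup (W t) u ≡ true → shortClass u ≡ false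
  shortClass-misses u Wu = Boolₚ.¬-not (λ su → without-≢ (class (col wₜ)) su
    (col-injective ℕₚ.≤-refl u wₜ Wu (proj₁ (proj₂ wₜ-new)) (proj₂ (class⁻ (without-⊆ (class (col wₜ)) su)))))

  polytopePoints : Σ (Fin (suc m) → Point n) λ p → (∀ j → Fface G W s (p j)) × AffinelyIndependent p
  polytopePoints =
    indicator shortClass Vector.∷ face , in-P ,
    affinelyIndependent-∷-offHyperplane (indicator shortClass) face (W t) face-independent
      (xsum-indicator-disjoint {W = W t} shortClass-misses) (λ j → proj₂ (Fface-suc⁻ (face∈F j)))
    where
    face = proj₁ facePoints
    face∈F = proj₁ (proj₂ facePoints)
    face-independent = proj₂ (proj₂ facePoints)
    in-P : ∀ j → Fface G W s ((indicator shortClass Vector.∷ face) j)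
    in-P zero    = indicator∈Fface {s = s} shortClass-stable (λ _ → shortClass-meets)
    in-P (suc j) = proj₁ (Fface-suc⁻ (face∈F j))

  vertex-count : suc n ≡ m ℕ.+ t
  vertex-count = begin
    suc n                               ≡⟨ cong suc (count-complement U) ⟨
    suc (count U ℕ.+ count outside)     ≡⟨ cong (λ c → suc (c ℕ.+ count outside))
                                             (trans (sym (∣∣≡count (Wunion W t))) (Wunion-size s t≤r)) ⟩
    suc (k ℕ.+ s ℕ.+ count outside)     ≡⟨ cong suc (ℕₚ.+-comm (k ℕ.+ s) (count outside)) ⟩
    suc (count outside ℕ.+ (k ℕ.+ s))   ≡⟨ cong suc (ℕₚ.+-assoc (count outside) k s) ⟨
    suc (m ℕ.+ s)                       ≡⟨ ℕₚ.+-suc m s ⟨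
    m ℕ.+ t                             ∎

  validity : ∀ x → Fface G W s x → xsum x (W t) ℚ.≤ 1ℚ
  validity x x∈P = clique-inequality (proj₁ (cliques t (s≤s z≤n) t≤r))
    (Fface⊆STAB G W s (λ j 1≤j j≤s → proj₁ (cliques j 1≤j (ℕₚ.≤-trans j≤s (ℕₚ.<⇒≤ t≤r)))) x∈P)

  polytopeDimension : MaxAffInd (Fface G W s) (suc m)
  polytopeDimension = polytopePoints , λ m′ p p∈P indep → ℕₚ.+-cancelʳ-≤ s m′ (suc m)
    (subst (m′ ℕ.+ s ≤_) (trans vertex-count (ℕₚ.+-suc m s))
           (Fface-bound (proj₂ (newVerticesUpTo (ℕₚ.<⇒≤ t≤r))) p p∈P indep))

  faceDimension : MaxAffInd (λ x → Fface G W s x × xsum x (W t) ≡ 1ℚ) m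
  faceDimension =
    (proj₁ facePoints , Fface-suc⁻ ∘ proj₁ (proj₂ facePoints) , proj₂ (proj₂ facePoints)) ,
    λ m′ p p∈F indep → ℕₚ.+-cancelʳ-≤ t m′ m
      (subst (m′ ℕ.+ t ≤_) vertex-count
             (Fface-bound (proj₂ (newVerticesUpTo t≤r)) p
                          (λ j → Fface-suc⁺ (proj₁ (p∈F j)) (proj₂ (p∈F j))) indep))

theorem2 : ∀ {n : ℕ} (G : Graph n) → IsSimpleGraph G →
  (r : ℕ) (W : ℕ → Subset n) →
  (∀ (i j : ℕ) → 1 ≤ i → i ≤ r → 1 ≤ j → j ≤ r → i ≢ j → W i ≢ W j) →
  (∀ (t : ℕ) → 1 ≤ t → t ≤ r → IsClique (Gseq G W (t ∸ 1)) (W t) × 2 ≤ ∣ W t ∣) →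
  (Σ ℕ λ k → 0 < k × (∀ (t : ℕ) → 1 ≤ t → t ≤ r →
    ∣ W t ∣ ≡ k ×
    Σ (Fin n → Fin k) λ col →
      (∀ (u v : Fin n) → u ∈ Wunion W t → v ∈ Wunion W t →
         Gseq G W (t ∸ 1) u v ≡ true → col u ≢ col v) ×
      StrongHypertree k (Wunion W t) (Wlist W t) ×
      (∀ (w : Fin n) → w ∉ Wunion W t →
         Σ (Fin k) λ i → ∀ (v : Fin n) → v ∈ Wunion W t → col v ≡ i →
           Gseq G W (t ∸ 1) w v ≡ false))) →
  ∀ (t : ℕ) → 1 ≤ t → t ≤ r →
    FacetDefining (Fface G W (t ∸ 1)) (λ x → xsum x (W t)) 1ℚ
theorem2 G simple r W _ cliques (k , k>0 , conditions) (suc s) _ t≤r =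
  validity , m , polytopeDimension , faceDimension
  where open FacetProof G simple r W cliques k k>0 conditions s t≤r
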